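{- Let $P$ be the $13$-element poset on $\{n_1,n_2,n_3,a_1,\dots,a_6,m_1,\dots,m_4\}$ whose order is the reflexive–transitive closure of the covering relations $n_1<a_1,a_2,a_3,a_5$; $n_2<a_2,a_3,a_4,a_6$; $n_3<a_1,a_4,a_5,a_6$; $a_1<m_1,m_2$; $a_2<m_1,m_3$; $a_3<m_2,m_4$; $a_4<m_2,m_3$; $a_5<m_3,m_4$; $a_6<m_1,m_4$ (the minimal finite model of $\mathbb{R}P^2$). Let $k$ be a commutative ring with no $2$-torsion (i.e. $2x=0$ implies $x=0$ for $x\in k$). Then every derivation of the incidence algebra $I(P,k)$ is inner; equivalently, every transitive function on $P$ with values in $k$ is potential.
   Context: A function $f$ on pairs $(x,y)$ with $x\le y$ in $P$, valued in $k$, is transitive if $f(x,z)=f(x,y)+f(y,z)$ whenever $x\le y\le z$, and potential if there exists $\varphi:P\to k$ with $f(x,y)=\varphi(y)-\varphi(x)$ for all $x\le y$. Transitive functions correspond bijectively to derivations of the incidence algebra $I(P,k)$, and potential ones to inner derivations. -}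

module Defs where

open import Level using (Level; _⊔_)
open import Data.Product using (Σ; ∃)
open import Algebra.Bundles using (CommutativeRing)
open import Relation.Binary.Construct.Closure.ReflexiveTransitive using (Star)

data Pt : Set where
  n1 n2 n3 : Pt
  a1 a2 a3 a4 a5 a6 : Pt
  m1 m2 m3 m4 : Pt

data _⋖_ : Pt → Pt → Set where
  n1a1 : n1 ⋖ a1
  n1a2 : n1 ⋖ a2
  n1a3 : n1 ⋖ a3
  n1a5 : n1 ⋖ a5
  n2a2 : n2 ⋖ a2
  n2a3 : n2 ⋖ a3
  n2a4 : n2 ⋖ a4
  n2a6 : n2 ⋖ a6
  n3a1 : n3 ⋖ a1
  n3a4 : n3 ⋖ a4
  n3a5 : n3 ⋖ a5
  n3a6 : n3 ⋖ a6
  a1m1 : a1 ⋖ m1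
  a1m2 : a1 ⋖ m2
  a2m1 : a2 ⋖ m1
  a2m3 : a2 ⋖ m3
  a3m2 : a3 ⋖ m2
  a3m4 : a3 ⋖ m4
  a4m2 : a4 ⋖ m2
  a4m3 : a4 ⋖ m3
  a5m3 : a5 ⋖ m3
  a5m4 : a5 ⋖ m4
  a6m1 : a6 ⋖ m1
  a6m4 : a6 ⋖ m4

_≤P_ : Pt → Pt → Set
_≤P_ = Star _⋖_

module _ {c ℓ : Level} (R : CommutativeRing c ℓ) where
  open CommutativeRing R

  No2Torsion : Set (c ⊔ ℓ)
  No2Torsion = ∀ x → x + x ≈ 0# → x ≈ 0#

  -- f is only ever evaluated on pairs x ≤ y; its values elsewhere are irrelevant.
  Transitive : (Pt → Pt → Carrier) → Set ℓ
  Transitive f = ∀ x y z → x ≤P y → y ≤P z → f x z ≈ f x y + f y z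

  Potential : (Pt → Pt → Carrier) → Set (c ⊔ ℓ)
  Potential f = Σ (Pt → Carrier) λ φ → ∀ x y → x ≤P y → f x y ≈ φ y - φ x

{-# OPTIONS --safe #-}
module Submission where

open import Level using (Level)
open import Algebra.Bundles using (CommutativeRing)
import Algebra.Properties.AbelianGroup as AbelianGroupProperties
import Algebra.Properties.CommutativeSemigroup as CommutativeSemigroupProperties
open import Data.Product using (_,_)
open import Relation.Binary.Construct.Closure.ReflexiveTransitive using (ε; _◅_; return)
import Relation.Binary.Reasoning.Setoid as SetoidReasoning

open import Defs

-- Integrating f along a spanning tree of the Hasse diagram gives a potential φ
-- whose defect δ = f - (φ y - φ x) is transitive and vanishes on the 12 tree
-- edges.  Every interval [nᵢ, mⱼ] is a square with two middle points a, a′, and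
-- transitivity of δ gives δ(n,a) + δ(a,m) = δ(n,a′) + δ(a′,m).  These 12 square
-- relations kill δ on 7 of the 12 remaining edges and make it equal to a single
-- value t on the other 5, with t + t = 0: the squares span the cycles of the
-- Hasse diagram only up to index 2, reflecting H₁(ℝP²) = ℤ/2.  Without
-- 2-torsion t = 0, so δ vanishes on all covers and hence on all of ≤.

module _ {c ℓ : Level} (R : CommutativeRing c ℓ) where
  open CommutativeRing R
  open AbelianGroupProperties +-abelianGroup
    using (xyx⁻¹≈y; ⁻¹-∙-comm; \\-leftDividesʳ; identityʳ-unique; x∙y⁻¹≈ε⇒x≈y)
  open CommutativeSemigroupProperties +-commutativeSemigroup using (interchange)
  open SetoidReasoning setoid

  x+y≈z⇒y≈z-x : ∀ {x y z} → x + y ≈ z → y ≈ z - x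
  x+y≈z⇒y≈z-x {x} {y} {z} x+y≈z = begin
    y          ≈⟨ xyx⁻¹≈y x y ⟨
    x + y - x  ≈⟨ +-congʳ x+y≈z ⟩
    z - x      ∎

  coboundary : (Pt → Carrier) → Pt → Pt → Carrier
  coboundary φ x y = φ y - φ x

  coboundary-transitive : ∀ φ → Transitive R (coboundary φ)
  coboundary-transitive φ x y z _ _ = sym (begin
    (φ y - φ x) + (φ z - φ y)    ≈⟨ +-comm _ _ ⟩
    (φ z - φ y) + (φ y - φ x)    ≈⟨ +-assoc _ _ _ ⟩
    φ z + (- φ y + (φ y - φ x))  ≈⟨ +-congˡ (\\-leftDividesʳ (φ y) (- φ x)) ⟩
    φ z - φ x                    ∎)

  difference-transitive : ∀ {f g} → Transitive R f → Transitive R g →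
                          Transitive R (λ x y → f x y - g x y)
  difference-transitive {f} {g} f-trans g-trans x y z x≤y y≤z = begin
    f x z - g x z                          ≈⟨ +-cong (f-trans x y z x≤y y≤z) (-‿cong (g-trans x y z x≤y y≤z)) ⟩
    (f x y + f y z) - (g x y + g y z)      ≈⟨ +-congˡ (⁻¹-∙-comm (g x y) (g y z)) ⟨
    (f x y + f y z) + (- g x y + - g y z)  ≈⟨ interchange (f x y) (f y z) (- g x y) (- g y z) ⟩
    (f x y - g x y) + (f y z - g y z)      ∎

  module TransitiveFunction {g : Pt → Pt → Carrier} (g-trans : Transitive R g) where

    diagonal≈0 : ∀ x → g x x ≈ 0#
    diagonal≈0 x = identityʳ-unique (g x x) (g x x) (sym (g-trans x x x ε ε))

    split-zeroˡ : ∀ {x y z} → x ≤P y → y ≤P z → g x y ≈ 0# → g x z ≈ g y z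
    split-zeroˡ {x} {y} {z} x≤y y≤z gxy≈0 = begin
      g x z          ≈⟨ g-trans x y z x≤y y≤z ⟩
      g x y + g y z  ≈⟨ +-congʳ gxy≈0 ⟩
      0# + g y z     ≈⟨ +-identityˡ (g y z) ⟩
      g y z          ∎

    split-zeroʳ : ∀ {x y z} → x ≤P y → y ≤P z → g y z ≈ 0# → g x z ≈ g x y
    split-zeroʳ {x} {y} {z} x≤y y≤z gyz≈0 = begin
      g x z          ≈⟨ g-trans x y z x≤y y≤z ⟩
      g x y + g y z  ≈⟨ +-congˡ gyz≈0 ⟩
      g x y + 0#     ≈⟨ +-identityʳ (g x y) ⟩
      g x y          ∎

    split-zero : ∀ {x y z} → x ≤P y → y ≤P z → g x y ≈ 0# → g y z ≈ 0# → g x z ≈ 0#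
    split-zero x≤y y≤z gxy≈0 gyz≈0 = trans (split-zeroˡ x≤y y≤z gxy≈0) gyz≈0

    vanishing-on-covers⇒vanishing : (∀ {x y} → x ⋖ y → g x y ≈ 0#) →
                                    ∀ x y → x ≤P y → g x y ≈ 0#
    vanishing-on-covers⇒vanishing g⋖≈0 x .x ε = diagonal≈0 x
    vanishing-on-covers⇒vanishing g⋖≈0 x z (x⋖y ◅ y≤z) =
      split-zero (return x⋖y) y≤z (g⋖≈0 x⋖y) (vanishing-on-covers⇒vanishing g⋖≈0 _ z y≤z)

  defect-vanishing⇒potential : ∀ {f} φ → (∀ x y → x ≤P y → f x y - coboundary φ x y ≈ 0#) →
                               Potential R f
  defect-vanishing⇒potential {f} φ defect≈0 =
    φ , λ x y x≤y → x∙y⁻¹≈ε⇒x≈y (f x y) (coboundary φ x y) (defect≈0 x y x≤y)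

module ℝP² {c ℓ : Level} (R : CommutativeRing c ℓ) (no2Torsion : No2Torsion R)
           (f : Pt → Pt → CommutativeRing.Carrier R) (f-trans : Transitive R f) where
  open CommutativeRing R
  open AbelianGroupProperties +-abelianGroup using (//-rightDividesˡ; x≈y⇒x∙y⁻¹≈ε)

  -- The spanning tree rooted at n₁ consists of the edges n₁ ⋖ a₁, a₂, a₃, a₅,
  -- a₁ ⋖ m₁, m₂, a₂ ⋖ m₃, a₃ ⋖ m₄, n₂ ⋖ a₂, a₄, a₆ and n₃ ⋖ a₁.
  φ : Pt → Carrier
  φ n1 = 0#
  φ a1 = f n1 a1
  φ a2 = f n1 a2
  φ a3 = f n1 a3
  φ a5 = f n1 a5
  φ m1 = f n1 a1 + f a1 m1
  φ m2 = f n1 a1 + f a1 m2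
  φ m3 = f n1 a2 + f a2 m3
  φ m4 = f n1 a3 + f a3 m4
  φ n2 = f n1 a2 - f n2 a2
  φ n3 = f n1 a1 - f n3 a1
  φ a4 = (f n1 a2 - f n2 a2) + f n2 a4
  φ a6 = (f n1 a2 - f n2 a2) + f n2 a6

  δ : Pt → Pt → Carrier
  δ x y = f x y - coboundary R φ x y

  δ-trans : Transitive R δ
  δ-trans = difference-transitive R f-trans (coboundary-transitive R φ)

  open TransitiveFunction R δ-trans

  tree-edge : ∀ {x y} → φ x + f x y ≈ φ y → δ x y ≈ 0#
  tree-edge φx+fxy≈φy = x≈y⇒x∙y⁻¹≈ε (x+y≈z⇒y≈z-x R φx+fxy≈φy)

  δ-n1a1 : δ n1 a1 ≈ 0#
  δ-n1a1 = tree-edge (+-identityˡ _)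
  δ-n1a2 : δ n1 a2 ≈ 0#
  δ-n1a2 = tree-edge (+-identityˡ _)
  δ-n1a3 : δ n1 a3 ≈ 0#
  δ-n1a3 = tree-edge (+-identityˡ _)
  δ-n1a5 : δ n1 a5 ≈ 0#
  δ-n1a5 = tree-edge (+-identityˡ _)
  δ-a1m1 : δ a1 m1 ≈ 0#
  δ-a1m1 = tree-edge refl
  δ-a1m2 : δ a1 m2 ≈ 0#
  δ-a1m2 = tree-edge refl
  δ-a2m3 : δ a2 m3 ≈ 0#
  δ-a2m3 = tree-edge refl
  δ-a3m4 : δ a3 m4 ≈ 0#
  δ-a3m4 = tree-edge refl
  δ-n2a2 : δ n2 a2 ≈ 0#
  δ-n2a2 = tree-edge (//-rightDividesˡ (f n2 a2) (f n1 a2))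
  δ-n2a4 : δ n2 a4 ≈ 0#
  δ-n2a4 = tree-edge refl
  δ-n2a6 : δ n2 a6 ≈ 0#
  δ-n2a6 = tree-edge refl
  δ-n3a1 : δ n3 a1 ≈ 0#
  δ-n3a1 = tree-edge (//-rightDividesˡ (f n3 a1) (f n1 a1))

  -- Each remaining edge is read off a square [n, m] whose other three sides are known.
  δ-a2m1 : δ a2 m1 ≈ 0#
  δ-a2m1 = trans (sym (split-zeroˡ (return n1a2) (return a2m1) δ-n1a2))
                 (split-zero (return n1a1) (return a1m1) δ-n1a1 δ-a1m1)
  δ-a3m2 : δ a3 m2 ≈ 0#
  δ-a3m2 = trans (sym (split-zeroˡ (return n1a3) (return a3m2) δ-n1a3))
                 (split-zero (return n1a1) (return a1m2) δ-n1a1 δ-a1m2)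
  δ-a5m3 : δ a5 m3 ≈ 0#
  δ-a5m3 = trans (sym (split-zeroˡ (return n1a5) (return a5m3) δ-n1a5))
                 (split-zero (return n1a2) (return a2m3) δ-n1a2 δ-a2m3)
  δ-a5m4 : δ a5 m4 ≈ 0#
  δ-a5m4 = trans (sym (split-zeroˡ (return n1a5) (return a5m4) δ-n1a5))
                 (split-zero (return n1a3) (return a3m4) δ-n1a3 δ-a3m4)
  δ-a6m1 : δ a6 m1 ≈ 0#
  δ-a6m1 = trans (sym (split-zeroˡ (return n2a6) (return a6m1) δ-n2a6))
                 (split-zero (return n2a2) (return a2m1) δ-n2a2 δ-a2m1)
  δ-a4m3 : δ a4 m3 ≈ 0#
  δ-a4m3 = trans (sym (split-zeroˡ (return n2a4) (return a4m3) δ-n2a4))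
                 (split-zero (return n2a2) (return a2m3) δ-n2a2 δ-a2m3)
  δ-n3a6 : δ n3 a6 ≈ 0#
  δ-n3a6 = trans (sym (split-zeroʳ (return n3a6) (return a6m1) δ-a6m1))
                 (split-zero (return n3a1) (return a1m1) δ-n3a1 δ-a1m1)

  t : Carrier
  t = δ n2 a3

  δ-a4m2≈t : δ a4 m2 ≈ t
  δ-a4m2≈t = trans (sym (split-zeroˡ (return n2a4) (return a4m2) δ-n2a4))
                   (split-zeroʳ (return n2a3) (return a3m2) δ-a3m2)
  δ-a6m4≈t : δ a6 m4 ≈ t
  δ-a6m4≈t = trans (sym (split-zeroˡ (return n2a6) (return a6m4) δ-n2a6))
                   (split-zeroʳ (return n2a3) (return a3m4) δ-a3m4)
  δ-n3a5≈t : δ n3 a5 ≈ t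
  δ-n3a5≈t = trans (sym (split-zeroʳ (return n3a5) (return a5m4) δ-a5m4))
                   (trans (split-zeroˡ (return n3a6) (return a6m4) δ-n3a6) δ-a6m4≈t)
  δ-n3a4≈t : δ n3 a4 ≈ t
  δ-n3a4≈t = trans (sym (split-zeroʳ (return n3a4) (return a4m3) δ-a4m3))
                   (trans (split-zeroʳ (return n3a5) (return a5m3) δ-a5m3) δ-n3a5≈t)

  t≈0 : t ≈ 0#
  t≈0 = no2Torsion t (begin
    t + t              ≈⟨ +-cong δ-n3a4≈t δ-a4m2≈t ⟨
    δ n3 a4 + δ a4 m2  ≈⟨ δ-trans n3 a4 m2 (return n3a4) (return a4m2) ⟨
    δ n3 m2            ≈⟨ split-zero (return n3a1) (return a1m2) δ-n3a1 δ-a1m2 ⟩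
    0#                 ∎)
    where open SetoidReasoning setoid

  δ-cover : ∀ {x y} → x ⋖ y → δ x y ≈ 0#
  δ-cover n1a1 = δ-n1a1
  δ-cover n1a2 = δ-n1a2
  δ-cover n1a3 = δ-n1a3
  δ-cover n1a5 = δ-n1a5
  δ-cover n2a2 = δ-n2a2
  δ-cover n2a3 = t≈0
  δ-cover n2a4 = δ-n2a4
  δ-cover n2a6 = δ-n2a6
  δ-cover n3a1 = δ-n3a1
  δ-cover n3a4 = trans δ-n3a4≈t t≈0
  δ-cover n3a5 = trans δ-n3a5≈t t≈0
  δ-cover n3a6 = δ-n3a6
  δ-cover a1m1 = δ-a1m1
  δ-cover a1m2 = δ-a1m2
  δ-cover a2m1 = δ-a2m1
  δ-cover a2m3 = δ-a2m3
  δ-cover a3m2 = δ-a3m2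
  δ-cover a3m4 = δ-a3m4
  δ-cover a4m2 = trans δ-a4m2≈t t≈0
  δ-cover a4m3 = δ-a4m3
  δ-cover a5m3 = δ-a5m3
  δ-cover a5m4 = δ-a5m4
  δ-cover a6m1 = δ-a6m1
  δ-cover a6m4 = trans δ-a6m4≈t t≈0

  f-potential : Potential R f
  f-potential = defect-vanishing⇒potential R φ (vanishing-on-covers⇒vanishing δ-cover)

mainTheorem6 : {c ℓ : Level} (R : CommutativeRing c ℓ) → No2Torsion R →
    (f : Pt → Pt → CommutativeRing.Carrier R) → Transitive R f → Potential R f
mainTheorem6 = ℝP².f-potential
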